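{- Let $n,r,t$ be integers with $r\ge 1$, $t\ge 1$ and $n \geq 2r+2t+2$. Then there is a graph $G$ on $n$ vertices (namely the complete graph $K_n$) such that the integrality gap of the level-$r$ Sherali–Adams tightening $\mathcal S^{(r)}(P_t(G))$ of the $t$-partial-vertex-cover LP relaxation is at least $\binom{n-2r}{2}/(t\cdot n)$; i.e. the minimum number of vertices of a $t$-partial vertex cover of $G$ divided by $\min\{\sum_{i\in V} x_i : x\in \mathcal S^{(r)}(P_t(G))\}$ is at least $\binom{n-2r}{2}/(t\cdot n)$.
   Context: For a graph $G=(V,E)$ and an integer $t\le |E|$, a $t$-partial vertex cover is a set $S\subseteq V$ such that at least $t$ edges have an endpoint in $S$; the unweighted $t$-Partial-Vertex-Cover problem asks for one of minimum size. Its LP relaxation has variables $x_q$, $q\in V\cup E$, objective $\min \sum_{i\in V} x_i$, and constraints: $x_i+x_j\ge x_e$ for every edge $e=\{i,j\}\in E$; $\sum_{e\in E} x_e\ge t$; $0\le x_q\le 1$ for all $q\in V\cup E$. Its feasible region is denoted $P_t(G)\subseteq[0,1]^m$ with ground set $[m]=V\cup E$. The integrality gap of a relaxation is the ratio of the optimal integral cost to the optimal value of the relaxation. Sherali–Adams system: let $P\subseteq[0,1]^m$ be given by linear constraints $a^Tx\ge b$. Its homogenization is the cone $K\subseteq\mathbb R^{\{\emptyset\}\cup[m]}$ of vectors $\bar x$ with $\bar x_\emptyset\ge 0$ and $a^T\bar x\ge b\,\bar x_\emptyset$ for each constraint (where $\bar x_{\{p\}}$ replaces $x_p$). Let $\mathcal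 P_r$ be the family of subsets of $[m]$ of size at most $r$. For $y\in\mathbb R^{\mathcal P_{r+1}}$, its moment matrix $\mathcal Y$ has rows indexed by $\mathcal P_1$, columns indexed by $\mathcal P_r$, and $\mathcal Y_{A,B}=y_{A\cup B}$; $\mathbf e_I$ denotes standard basis vectors. The level-$r$ Sherali–Adams cone $M^{(r)}$ is the set of $x\in\mathbb R^{\mathcal P_1}$ for which there is $y\in\mathbb R^{\mathcal P_{r+1}}$ with $\mathcal Y\mathbf e_\emptyset=x$ and, for all $Y,N\subseteq[m]$ with $Y\cup N\in\mathcal P_r$, $\mathcal Y\sum_{T\subseteq N}(-1)^{|T|}\mathbf e_{Y\cup T}\in K$. The level-$r$ tightening is $\mathcal S^{(r)}(P)=M^{(r)}\cap\{x_\emptyset=1\}$, viewed as a subset of $[0,1]^m$. -}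

module Defs where

open import Data.Nat as ℕ using (ℕ; zero; suc)
open import Data.Integer using (+_)
open import Data.Rational using (ℚ; 0ℚ; 1ℚ; _+_; _-_; _*_; -_; _≤_; _/_)
open import Data.Fin using (Fin; _↑ˡ_; _↑ʳ_; splitAt; _<?_; _≟_)
open import Data.Fin.Subset using (Subset; ⊥; ⁅_⁆; _∪_; ∣_∣)
open import Data.Vec using (Vec; []; _∷_; lookup)
open import Data.Bool using (Bool; true; false; if_then_else_; _∨_)
open import Data.List as List using (List; length; filter; cartesianProduct; allFin)
open import Data.List.Relation.Unary.All using (All)
open import Data.Product using (_×_; _,_; proj₁; proj₂; ∃)
open import Data.Sum using (inj₁; inj₂)
open import Relation.Nullary.Decidable using (⌊_⌋)
open import Relation.Binary.PropositionalEquality using (_≡_)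

sumℚ : ∀ {m} → (Fin m → ℚ) → ℚ
sumℚ {zero}  f = 0ℚ
sumℚ {suc m} f = f Data.Fin.zero + sumℚ (λ i → f (Data.Fin.suc i))

sumℕ : ∀ {m} → (Fin m → ℕ) → ℕ
sumℕ {zero}  f = 0
sumℕ {suc m} f = f Data.Fin.zero ℕ.+ sumℕ (λ i → f (Data.Fin.suc i))

ℕtoℚ : ℕ → ℚ
ℕtoℚ k = + k / 1

record LinCon (m : ℕ) : Set where
  field
    coef : Fin m → ℚ
    rhs  : ℚ
open LinCon public

LinSystem : ℕ → Set
LinSystem m = List (LinCon m)

dot : ∀ {m} → (Fin m → ℚ) → (Fin m → ℚ) → ℚ
dot a x = sumℚ (λ p → a p * x p)

-- Homogenization cone K: a vector  x̄ ∈ ℝ^{ {∅} ∪ [m] }  is given by its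
-- ∅-coordinate z∅ and its singleton coordinates zs.
InCone : ∀ {m} → LinSystem m → ℚ → (Fin m → ℚ) → Set
InCone sys z∅ zs = (0ℚ ≤ z∅) × All (λ c → rhs c * z∅ ≤ dot (coef c) zs) sys

-- signedSum N f = Σ_{T ⊆ N} (-1)^{|T|} f T
signedSum : ∀ {m} → Subset m → (Subset m → ℚ) → ℚ
signedSum {zero}  []          f = f []
signedSum {suc m} (false ∷ N) f = signedSum N (λ T → f (false ∷ T))
signedSum {suc m} (true  ∷ N) f =
  signedSum N (λ T → f (false ∷ T)) - signedSum N (λ T → f (true ∷ T))

-- For y ∈ ℝ^{P_{r+1}} (values outside P_{r+1} are irrelevant), the vector
--   𝒴 Σ_{T⊆N} (-1)^{|T|} e_{Y∪T}  ∈ ℝ^{P_1},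
-- whose A-coordinate (A ∈ P_1) is  Σ_{T⊆N} (-1)^{|T|} y_{A ∪ Y ∪ T}.
momentCol : ∀ {m} → (Subset m → ℚ) → Subset m → Subset m → Subset m → ℚ
momentCol y Y N A = signedSum N (λ T → y (A ∪ (Y ∪ T)))

-- x ∈ 𝒮^(r)(P), P given by the system sys; x : [m] → ℚ (the x_∅ = 1 slice)
InSA : ∀ {m} → ℕ → LinSystem m → (Fin m → ℚ) → Set
InSA {m} r sys x =
  ∃ λ (y : Subset m → ℚ) →
      (y ⊥ ≡ 1ℚ)
    × (∀ p → x p ≡ y ⁅ p ⁆)
    × (∀ (Y N : Subset m) → ∣ Y ∪ N ∣ ℕ.≤ r →
         InCone sys (momentCol y Y N ⊥) (λ p → momentCol y Y N ⁅ p ⁆))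

record Graph : Set where
  field
    nV   : ℕ
    nE   : ℕ
    ends : Fin nE → Fin nV × Fin nV
open Graph public

edgesK : (n : ℕ) → List (Fin n × Fin n)
edgesK n = filter (λ e → proj₁ e <? proj₂ e) (cartesianProduct (allFin n) (allFin n))

completeGraph : ℕ → Graph
completeGraph n = record
  { nV = n
  ; nE = length (edgesK n)
  ; ends = List.lookup (edgesK n)
  }

coveredEdges : (G : Graph) → Subset (nV G) → ℕ
coveredEdges G S =
  sumℕ (λ e → if lookup S (proj₁ (ends G e)) ∨ lookup S (proj₂ (ends G e)) then 1 else 0)

IsPartialVC : (G : Graph) → ℕ → Subset (nV G) → Set
IsPartialVC G t S = t ℕ.≤ coveredEdges G S

IsMinPartialVC : (G : Graph) → ℕ → ℕ → Set
IsMinPartialVC G t k =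
  (∃ λ S → IsPartialVC G t S × ∣ S ∣ ≡ k)
  × (∀ S → IsPartialVC G t S → k ℕ.≤ ∣ S ∣)

-- ground set [m] = V ∪ E, vertices first, then edges
groundSize : Graph → ℕ
groundSize G = nV G ℕ.+ nE G

vtx : (G : Graph) → Fin (nV G) → Fin (groundSize G)
vtx G i = i ↑ˡ nE G

edg : (G : Graph) → Fin (nE G) → Fin (groundSize G)
edg G e = nV G ↑ʳ e

δ : ∀ {m} → Fin m → Fin m → ℚ
δ q p = if ⌊ q ≟ p ⌋ then 1ℚ else 0ℚ

isEdge : (G : Graph) → Fin (groundSize G) → ℚ
isEdge G p with splitAt (nV G) p
... | inj₁ _ = 0ℚ
... | inj₂ _ = 1ℚ

-- The constraints of P_t(G):
--   x_i + x_j - x_e ≥ 0  (e = {i,j} ∈ E);  Σ_e x_e ≥ t;  x_q ≥ 0;  -x_q ≥ -1.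
PVCSystem : (G : Graph) → ℕ → LinSystem (groundSize G)
PVCSystem G t =
     List.map edgeCon (allFin (nE G))
  List.++ (record { coef = isEdge G ; rhs = ℕtoℚ t } List.∷ List.[])
  List.++ List.map (λ q → record { coef = δ q ; rhs = 0ℚ }) (allFin (groundSize G))
  List.++ List.map (λ q → record { coef = λ p → - δ q p ; rhs = - 1ℚ }) (allFin (groundSize G))
  where
    edgeCon : Fin (nE G) → LinCon (groundSize G)
    edgeCon e = record
      { coef = λ p → δ (vtx G (proj₁ (ends G e))) p + δ (vtx G (proj₂ (ends G e))) p
                     - δ (edg G e) p
      ; rhs  = 0ℚ }

vertexSum : (G : Graph) → (Fin (groundSize G) → ℚ) → ℚ
vertexSum G x = sumℚ (λ i → x (vtx G i))

-- The witness x is the level-r moment vector of a nonnegative combination of integral points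
-- of {0,1}^(V ∪ E): the empty set, with weight a = s (n − 1 − t) where s = n − 2r, and each of
-- the n stars of K_n (a vertex together with its n − 1 edges), with weight t; it is normalised
-- by a + n t. Every Sherali–Adams column (Y, N) of such a vector is again a combination of the
-- same points, restricted to those Z with Y ⊆ Z and N ∩ Z = ∅. The constraints x_e ≤ x_i + x_j
-- and 0 ≤ x_q ≤ x_∅ therefore hold point by point. The covering constraint fails for the empty
-- set, but a column with Y = ∅ loses at most 2|N| ≤ 2r stars, and the at least s surviving stars
-- carry enough edges to pay for the weight a. Finally x has objective n t / (a + n t), every
-- t-partial cover has a vertex, and C(s, 2) ≤ a.

module Submission where

open import Defs
open import Data.Nat using (ℕ)
import Data.Nat as ℕ
open import Data.Bool using (Bool; true; false; not; _∧_; _∨_; if_then_else_)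
open import Data.Fin using (Fin; zero; suc; _≟_)
import Data.Fin
open import Data.Fin.Subset using (Subset; ⊥; ⁅_⁆; _∪_; ∣_∣)
open import Data.Vec using ([]; _∷_; lookup)
open import Data.Product using (_×_; _,_; proj₁; proj₂; ∃)
open import Relation.Nullary.Decidable using (⌊_⌋; yes; no)
open import Relation.Nullary using (contradiction)
open import Relation.Binary.PropositionalEquality

module Counting where

  open import Data.Nat hiding (_≟_)
  open import Data.Nat.Properties hiding (_≟_)
  open import Data.Bool.Properties using (∧-zeroʳ; ∧-identityʳ)
  open import Data.Vec.Properties using (lookup-replicate)

  𝟙 : Bool → ℕ
  𝟙 b = if b then 1 else 0

  𝟙-∧ : ∀ x y → 𝟙 (x ∧ y) ≡ 𝟙 x * 𝟙 y
  𝟙-∧ true  y = sym (+-identityʳ (𝟙 y))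
  𝟙-∧ false y = refl

  𝟙-∨ : ∀ x y → 𝟙 (x ∨ y) ≤ 𝟙 x + 𝟙 y
  𝟙-∨ true  y = s≤s z≤n
  𝟙-∨ false y = ≤-refl

  𝟙+𝟙-not : ∀ b → 𝟙 b + 𝟙 (not b) ≡ 1
  𝟙+𝟙-not true  = refl
  𝟙+𝟙-not false = refl

  𝟙*-≤ : ∀ b k → 𝟙 b * k ≤ k
  𝟙*-≤ true  k = ≤-reflexive (+-identityʳ k)
  𝟙*-≤ false k = z≤n

  sumℕ-cong : ∀ {m} {f g : Fin m → ℕ} → (∀ i → f i ≡ g i) → sumℕ f ≡ sumℕ g
  sumℕ-cong {zero}  f≗g = refl
  sumℕ-cong {suc m} f≗g = cong₂ _+_ (f≗g zero) (sumℕ-cong (λ i → f≗g (suc i)))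

  sumℕ-mono : ∀ {m} {f g : Fin m → ℕ} → (∀ i → f i ≤ g i) → sumℕ f ≤ sumℕ g
  sumℕ-mono {zero}  f≤g = z≤n
  sumℕ-mono {suc m} f≤g = +-mono-≤ (f≤g zero) (sumℕ-mono (λ i → f≤g (suc i)))

  sumℕ-const : ∀ m k → sumℕ {m} (λ _ → k) ≡ m * k
  sumℕ-const zero    k = refl
  sumℕ-const (suc m) k = cong (k +_) (sumℕ-const m k)

  sumℕ-distrib-+ : ∀ {m} (f g : Fin m → ℕ) → sumℕ (λ i → f i + g i) ≡ sumℕ f + sumℕ g
  sumℕ-distrib-+ {zero}  f g = refl
  sumℕ-distrib-+ {suc m} f g =
    trans (cong ((f zero + g zero) +_) (sumℕ-distrib-+ (λ i → f (suc i)) (λ i → g (suc i))))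
          (+-interchange (f zero) (g zero) (sumℕ (λ i → f (suc i))) (sumℕ (λ i → g (suc i))))
    where open import Algebra.Properties.CommutativeSemigroup +-commutativeSemigroup
            renaming (interchange to +-interchange)

  sumℕ-*ˡ : ∀ {m} c (f : Fin m → ℕ) → sumℕ (λ i → c * f i) ≡ c * sumℕ f
  sumℕ-*ˡ {zero}  c f = sym (*-zeroʳ c)
  sumℕ-*ˡ {suc m} c f = trans (cong (c * f zero +_) (sumℕ-*ˡ c (λ i → f (suc i))))
                              (sym (*-distribˡ-+ c (f zero) _))

  sumℕ-*ʳ : ∀ {m} c (f : Fin m → ℕ) → sumℕ (λ i → f i * c) ≡ sumℕ f * c
  sumℕ-*ʳ c f = trans (sumℕ-cong (λ i → *-comm (f i) c)) (trans (sumℕ-*ˡ c f) (*-comm c (sumℕ f)))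

  sumℕ-comm : ∀ {m k} (f : Fin m → Fin k → ℕ) →
    sumℕ (λ i → sumℕ (λ j → f i j)) ≡ sumℕ (λ j → sumℕ (λ i → f i j))
  sumℕ-comm {zero}  {k} f = sym (trans (sumℕ-const k 0) (*-zeroʳ k))
  sumℕ-comm {suc m} {k} f =
    trans (cong (sumℕ (f zero) +_) (sumℕ-comm (λ i → f (suc i))))
          (sym (sumℕ-distrib-+ (f zero) (λ j → sumℕ (λ i → f (suc i) j))))

  ⌊≟⌋-sym : ∀ {m} (i j : Fin m) → ⌊ i ≟ j ⌋ ≡ ⌊ j ≟ i ⌋
  ⌊≟⌋-sym i j with i ≟ j | j ≟ i
  ... | yes _    | yes _   = refl
  ... | yes refl | no j≢i  = contradiction refl j≢i
  ... | no i≢j   | yes refl = contradiction refl i≢j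
  ... | no _     | no _    = refl

  ⌊suc≟suc⌋ : ∀ {m} (i j : Fin m) → ⌊ suc i ≟ suc j ⌋ ≡ ⌊ i ≟ j ⌋
  ⌊suc≟suc⌋ i j with i ≟ j
  ... | yes _ = refl
  ... | no _  = refl

  sumℕ-select : ∀ {m} (i : Fin m) (f : Fin m → ℕ) → sumℕ (λ j → 𝟙 ⌊ j ≟ i ⌋ * f j) ≡ f i
  sumℕ-select {suc m} zero f = begin
    f zero + 0 + sumℕ {m} (λ _ → 0) ≡⟨ cong (f zero + 0 +_) (trans (sumℕ-const m 0) (*-zeroʳ m)) ⟩
    f zero + 0 + 0                  ≡⟨ trans (+-identityʳ _) (+-identityʳ _) ⟩
    f zero                          ∎
    where open ≡-Reasoning
  sumℕ-select {suc m} (suc i) f =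
    trans (sumℕ-cong (λ j → cong (λ b → 𝟙 b * f (suc j)) (⌊suc≟suc⌋ j i))) (sumℕ-select i (λ j → f (suc j)))

  sumℕ-𝟙≟ : ∀ {m} (i : Fin m) → sumℕ (λ j → 𝟙 ⌊ i ≟ j ⌋) ≡ 1
  sumℕ-𝟙≟ i = trans (sumℕ-cong (λ j → trans (cong 𝟙 (⌊≟⌋-sym i j)) (sym (*-identityʳ _))))
                    (sumℕ-select i (λ _ → 1))

  infix 5 _⊆ᵇ_

  _⊆ᵇ_ : ∀ {m} → Subset m → Subset m → Bool
  []      ⊆ᵇ []      = true
  (x ∷ p) ⊆ᵇ (y ∷ q) = (not x ∨ y) ∧ (p ⊆ᵇ q)

  disjointᵇ : ∀ {m} → Subset m → Subset m → Bool
  disjointᵇ []      []      = true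
  disjointᵇ (x ∷ p) (y ∷ q) = not (x ∧ y) ∧ disjointᵇ p q

  lookup-⊥ : ∀ {m} (p : Fin m) → lookup ⊥ p ≡ false
  lookup-⊥ p = lookup-replicate p false

  ⊥⊆ᵇ : ∀ {m} (q : Subset m) → ⊥ ⊆ᵇ q ≡ true
  ⊥⊆ᵇ []      = refl
  ⊥⊆ᵇ (y ∷ q) = ⊥⊆ᵇ q

  ⊆ᵇ⊥⇒≡⊥ : ∀ {m} (p : Subset m) → p ⊆ᵇ ⊥ ≡ true → p ≡ ⊥
  ⊆ᵇ⊥⇒≡⊥ []          _  = refl
  ⊆ᵇ⊥⇒≡⊥ (false ∷ p) eq = cong (false ∷_) (⊆ᵇ⊥⇒≡⊥ p eq)

  ∪-⊆ᵇ : ∀ {m} (p q z : Subset m) → p ∪ q ⊆ᵇ z ≡ (p ⊆ᵇ z) ∧ (q ⊆ᵇ z)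
  ∪-⊆ᵇ []      []      []      = refl
  ∪-⊆ᵇ (x ∷ p) (y ∷ q) (w ∷ z) rewrite ∪-⊆ᵇ p q z with x | y | w
  ... | true  | _     | false = refl
  ... | true  | true  | true  = refl
  ... | true  | false | true  = refl
  ... | false | true  | false = sym (∧-zeroʳ _)
  ... | false | true  | true  = refl
  ... | false | false | _     = refl

  ⁅⁆⊆ᵇ : ∀ {m} (i : Fin m) (q : Subset m) → ⁅ i ⁆ ⊆ᵇ q ≡ lookup q i
  ⁅⁆⊆ᵇ zero    (y ∷ q) rewrite ⊥⊆ᵇ q = ∧-identityʳ y
  ⁅⁆⊆ᵇ (suc i) (y ∷ q) = ⁅⁆⊆ᵇ i q

  disjointᵇ-⊥ : ∀ {m} (p : Subset m) → disjointᵇ p ⊥ ≡ true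
  disjointᵇ-⊥ []          = refl
  disjointᵇ-⊥ (true ∷ p)  = disjointᵇ-⊥ p
  disjointᵇ-⊥ (false ∷ p) = disjointᵇ-⊥ p

  sumℕ-lookup≡∣∣ : ∀ {m} (p : Subset m) → sumℕ (λ i → 𝟙 (lookup p i)) ≡ ∣ p ∣
  sumℕ-lookup≡∣∣ []          = refl
  sumℕ-lookup≡∣∣ (true ∷ p)  = cong suc (sumℕ-lookup≡∣∣ p)
  sumℕ-lookup≡∣∣ (false ∷ p) = sumℕ-lookup≡∣∣ p

  𝟙-meets≤ : ∀ {m} (p q : Subset m) → 𝟙 (not (disjointᵇ p q)) ≤ sumℕ (λ i → 𝟙 (lookup p i ∧ lookup q i))
  𝟙-meets≤ []          []          = z≤n
  𝟙-meets≤ (true ∷ p)  (true ∷ q)  = s≤s z≤n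
  𝟙-meets≤ (true ∷ p)  (false ∷ q) = 𝟙-meets≤ p q
  𝟙-meets≤ (false ∷ p) (y ∷ q)     = 𝟙-meets≤ p q

  meeting-count≤ : ∀ {m k} c (Z : Fin k → Subset m) → (∀ i → sumℕ (λ v → 𝟙 (lookup (Z v) i)) ≤ c) →
    ∀ N → sumℕ (λ v → 𝟙 (not (disjointᵇ N (Z v)))) ≤ c * ∣ N ∣
  meeting-count≤ c Z few N = begin
    sumℕ (λ v → 𝟙 (not (disjointᵇ N (Z v))))
      ≤⟨ sumℕ-mono (λ v → 𝟙-meets≤ N (Z v)) ⟩
    sumℕ (λ v → sumℕ (λ i → 𝟙 (lookup N i ∧ lookup (Z v) i)))
      ≡⟨ sumℕ-comm (λ v i → 𝟙 (lookup N i ∧ lookup (Z v) i)) ⟩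
    sumℕ (λ i → sumℕ (λ v → 𝟙 (lookup N i ∧ lookup (Z v) i)))
      ≡⟨ sumℕ-cong (λ i → trans (sumℕ-cong (λ v → 𝟙-∧ (lookup N i) (lookup (Z v) i)))
                                (sumℕ-*ˡ (𝟙 (lookup N i)) (λ v → 𝟙 (lookup (Z v) i)))) ⟩
    sumℕ (λ i → 𝟙 (lookup N i) * sumℕ (λ v → 𝟙 (lookup (Z v) i)))
      ≤⟨ sumℕ-mono (λ i → *-monoʳ-≤ (𝟙 (lookup N i)) (few i)) ⟩
    sumℕ (λ i → 𝟙 (lookup N i) * c)
      ≡⟨ trans (sumℕ-*ʳ c (λ i → 𝟙 (lookup N i))) (cong (_* c) (sumℕ-lookup≡∣∣ N)) ⟩
    ∣ N ∣ * c
      ≡⟨ *-comm ∣ N ∣ c ⟩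
    c * ∣ N ∣ ∎
    where open ≤-Reasoning

module Degrees where

  open import Data.Nat hiding (_≟_; _<?_)
  open import Data.Nat.Properties hiding (_≟_; _<?_)
  open import Data.Nat.ListAction using (sum)
  open import Data.Nat.ListAction.Properties using (sum-++)
  open import Data.Fin using (_<?_)
  import Data.Fin.Properties as Fin
  open import Data.List as List using (List; []; _∷_; map; filter; cartesianProduct; allFin)
  open import Data.List.Properties using (map-++; map-∘; map-tabulate)
  open import Relation.Nullary using (Dec; does)
  open import Relation.Nullary.Decidable using (dec-true; dec-false)
  open import Relation.Binary using (tri<; tri≈; tri>)
  open Counting

  incident : (G : Graph) → Fin (nV G) → Fin (nE G) → Bool
  incident G v e = ⌊ proj₁ (ends G e) ≟ v ⌋ ∨ ⌊ proj₂ (ends G e) ≟ v ⌋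

  degree : (G : Graph) → Fin (nV G) → ℕ
  degree G v = sumℕ (λ e → 𝟙 (incident G v e))

  module _ {A : Set} where

    sumℕ-lookup : (xs : List A) (g : A → ℕ) → sumℕ (λ i → g (List.lookup xs i)) ≡ sum (map g xs)
    sumℕ-lookup []       g = refl
    sumℕ-lookup (x ∷ xs) g = cong (g x +_) (sumℕ-lookup xs g)

    sum-map-filter : ∀ {P : A → Set} (P? : ∀ x → Dec (P x)) (g : A → ℕ) xs →
      sum (map g (filter P? xs)) ≡ sum (map (λ x → if does (P? x) then g x else 0) xs)
    sum-map-filter P? g []       = refl
    sum-map-filter P? g (x ∷ xs) with does (P? x)
    ... | true  = cong (g x +_) (sum-map-filter P? g xs)
    ... | false = sum-map-filter P? g xs

  sum-map-cartesianProduct : ∀ {A B : Set} (g : A × B → ℕ) xs ys →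
    sum (map g (cartesianProduct xs ys)) ≡ sum (map (λ x → sum (map (λ y → g (x , y)) ys)) xs)
  sum-map-cartesianProduct g []       ys = refl
  sum-map-cartesianProduct g (x ∷ xs) ys = begin
    sum (map g (map (x ,_) ys List.++ cartesianProduct xs ys))
      ≡⟨ cong sum (map-++ g (map (x ,_) ys) (cartesianProduct xs ys)) ⟩
    sum (map g (map (x ,_) ys) List.++ map g (cartesianProduct xs ys))
      ≡⟨ sum-++ (map g (map (x ,_) ys)) _ ⟩
    sum (map g (map (x ,_) ys)) + sum (map g (cartesianProduct xs ys))
      ≡⟨ cong₂ _+_ (cong sum (sym (map-∘ ys))) (sum-map-cartesianProduct g xs ys) ⟩
    sum (map (λ y → g (x , y)) ys) + sum (map (λ x → sum (map (λ y → g (x , y)) ys)) xs) ∎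
    where open ≡-Reasoning

  sum-tabulate : ∀ {n} (h : Fin n → ℕ) → sum (List.tabulate h) ≡ sumℕ h
  sum-tabulate {zero}  h = refl
  sum-tabulate {suc n} h = cong (h zero +_) (sum-tabulate (λ i → h (suc i)))

  sum-map-allFin : ∀ n (h : Fin n → ℕ) → sum (map h (allFin n)) ≡ sumℕ h
  sum-map-allFin n h = trans (cong sum (map-tabulate (λ i → i) h)) (sum-tabulate h)

  sumℕ-edgesK : ∀ n (f : Fin n × Fin n → ℕ) →
    sumℕ (λ e → f (List.lookup (edgesK n) e)) ≡ sumℕ (λ i → sumℕ (λ j → if does (i <? j) then f (i , j) else 0))
  sumℕ-edgesK n f = begin
    sumℕ (λ e → f (List.lookup (edgesK n) e))
      ≡⟨ sumℕ-lookup (edgesK n) f ⟩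
    sum (map f (edgesK n))
      ≡⟨ sum-map-filter (λ e → proj₁ e <? proj₂ e) f (cartesianProduct (allFin n) (allFin n)) ⟩
    sum (map f< (cartesianProduct (allFin n) (allFin n)))
      ≡⟨ sum-map-cartesianProduct f< (allFin n) (allFin n) ⟩
    sum (map (λ i → sum (map (λ j → f< (i , j)) (allFin n))) (allFin n))
      ≡⟨ sum-map-allFin n _ ⟩
    sumℕ (λ i → sum (map (λ j → f< (i , j)) (allFin n)))
      ≡⟨ sumℕ-cong (λ i → sum-map-allFin n (λ j → f< (i , j))) ⟩
    sumℕ (λ i → sumℕ (λ j → f< (i , j))) ∎
    where
    open ≡-Reasoning
    f< : Fin n × Fin n → ℕ
    f< e = if does (proj₁ e <? proj₂ e) then f e else 0

  𝟙< : ∀ {n} → Fin n → Fin n → ℕ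
  𝟙< i j = 𝟙 (does (i <? j))

  n≤pairs-at+1 : ∀ n (v : Fin n) → n ≤ sumℕ (𝟙< v) + sumℕ (λ j → 𝟙< j v) + 1
  n≤pairs-at+1 n v = begin
    n                                        ≡⟨ trans (sym (*-identityʳ n)) (sym (sumℕ-const n 1)) ⟩
    sumℕ {n} (λ _ → 1)                      ≤⟨ sumℕ-mono every-j-counted ⟩
    sumℕ (λ j → 𝟙< v j + 𝟙< j v + 𝟙 ⌊ v ≟ j ⌋)
      ≡⟨ trans (sumℕ-distrib-+ (λ j → 𝟙< v j + 𝟙< j v) (λ j → 𝟙 ⌊ v ≟ j ⌋))
               (cong₂ _+_ (sumℕ-distrib-+ (𝟙< v) (λ j → 𝟙< j v)) (sumℕ-𝟙≟ v)) ⟩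
    sumℕ (𝟙< v) + sumℕ (λ j → 𝟙< j v) + 1 ∎
    where
    open ≤-Reasoning
    every-j-counted : ∀ j → 1 ≤ 𝟙< v j + 𝟙< j v + 𝟙 ⌊ v ≟ j ⌋
    every-j-counted j with Fin.<-cmp v j
    ... | tri< v<j _ _ rewrite dec-true (v <? j) v<j = s≤s z≤n
    ... | tri> _ _ j<v rewrite dec-true (j <? v) j<v = ≤-trans (m≤n+m 1 (𝟙< v j)) (m≤m+n (𝟙< v j + 1) _)
    ... | tri≈ _ refl _ with v ≟ v
    ...   | yes _   = m≤n+m 1 _
    ...   | no v≢v = contradiction refl v≢v

  pairs-at≤degree-K : ∀ n v → sumℕ (𝟙< v) + sumℕ (λ i → 𝟙< i v) ≤ degree (completeGraph n) v
  pairs-at≤degree-K n v = begin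
    sumℕ (𝟙< v) + sumℕ (λ i → 𝟙< i v)
      ≡⟨ cong₂ _+_ (sym (sumℕ-select v (λ i → sumℕ (𝟙< i))))
                   (sumℕ-cong (λ i → sym (sumℕ-select v (𝟙< i)))) ⟩
    sumℕ (λ i → 𝟙 ⌊ i ≟ v ⌋ * sumℕ (𝟙< i)) + sumℕ (λ i → sumℕ (vRight i))
      ≡⟨ cong (_+ sumℕ (λ i → sumℕ (vRight i))) (sumℕ-cong (λ i → sym (sumℕ-*ˡ (𝟙 ⌊ i ≟ v ⌋) (𝟙< i)))) ⟩
    sumℕ (λ i → sumℕ (vLeft i)) + sumℕ (λ i → sumℕ (vRight i))
      ≡⟨ sumℕ-distrib-+ (λ i → sumℕ (vLeft i)) (λ i → sumℕ (vRight i)) ⟨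
    sumℕ (λ i → sumℕ (vLeft i) + sumℕ (vRight i))
      ≡⟨ sumℕ-cong (λ i → sumℕ-distrib-+ (vLeft i) (vRight i)) ⟨
    sumℕ (λ i → sumℕ (λ j → vLeft i j + vRight i j))
      ≤⟨ sumℕ-mono (λ i → sumℕ-mono (λ j → pair-contribution i j)) ⟩
    sumℕ (λ i → sumℕ (λ j → if does (i <? j) then g (i , j) else 0))
      ≡⟨ sumℕ-edgesK n g ⟨
    degree (completeGraph n) v ∎
    where
    open ≤-Reasoning
    vLeft vRight : Fin n → Fin n → ℕ
    vLeft  i j = 𝟙 ⌊ i ≟ v ⌋ * 𝟙< i j
    vRight i j = 𝟙 ⌊ j ≟ v ⌋ * 𝟙< i j

    g : Fin n × Fin n → ℕ
    g e = 𝟙 (⌊ proj₁ e ≟ v ⌋ ∨ ⌊ proj₂ e ≟ v ⌋)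

    no-pair : ∀ i j → 𝟙 ⌊ i ≟ v ⌋ * 0 + 𝟙 ⌊ j ≟ v ⌋ * 0 ≡ 0
    no-pair i j = cong₂ _+_ (*-zeroʳ (𝟙 ⌊ i ≟ v ⌋)) (*-zeroʳ (𝟙 ⌊ j ≟ v ⌋))

    pair-contribution : ∀ i j → vLeft i j + vRight i j ≤ (if does (i <? j) then g (i , j) else 0)
    pair-contribution i j with Fin.<-cmp i j
    ... | tri≈ i≮j _ _ rewrite dec-false (i <? j) i≮j = ≤-reflexive (no-pair i j)
    ... | tri> i≮j _ _ rewrite dec-false (i <? j) i≮j = ≤-reflexive (no-pair i j)
    ... | tri< i<j _ _ rewrite dec-true (i <? j) i<j with i ≟ v | j ≟ v
    ...   | yes refl | yes refl = contradiction i<j (Fin.<-irrefl refl)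
    ...   | yes _    | no _     = ≤-refl
    ...   | no _     | yes _    = ≤-refl
    ...   | no _     | no _     = ≤-refl

  n∸1≤degree-K : ∀ n v → n ∸ 1 ≤ degree (completeGraph n) v
  n∸1≤degree-K n v = begin
    n ∸ 1                                           ≤⟨ ∸-monoˡ-≤ 1 (n≤pairs-at+1 n v) ⟩
    sumℕ (𝟙< v) + sumℕ (λ j → 𝟙< j v) + 1 ∸ 1      ≡⟨ m+n∸n≡m _ 1 ⟩
    sumℕ (𝟙< v) + sumℕ (λ j → 𝟙< j v)              ≤⟨ pairs-at≤degree-K n v ⟩
    degree (completeGraph n) v ∎
    where open ≤-Reasoning

module Rationals where

  import Data.Nat.Properties as ℕ
  import Data.Integer as ℤ
  import Data.Integer.Properties as ℤ
  open import Data.Rational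
    using (ℚ; mkℚ; 0ℚ; 1ℚ; _+_; _*_; _-_; -_; _≤_; 1/_; NonNegative; Positive; NonZero; toℚᵘ)
  open import Data.Rational.Properties hiding (_≟_)
  import Data.Rational.Unnormalised as ℚᵘ
  import Data.Rational.Unnormalised.Properties as ℚᵘ
  import Data.Nat.Coprimality as Coprime
  open import Data.Fin using (_↑ˡ_; _↑ʳ_)
  open import Algebra.Bundles using (CommutativeRing; CommutativeMonoid)
  open import Algebra.Properties.CommutativeSemigroup
    (CommutativeMonoid.commutativeSemigroup (CommutativeRing.+-commutativeMonoid +-*-commutativeRing))
    renaming (interchange to +-interchange)
  open Counting using (𝟙; _⊆ᵇ_; disjointᵇ)
  open import Data.Bool.Properties using (∧-zeroʳ)

  ℕtoℚ≡mkℚ : ∀ k → ℕtoℚ k ≡ mkℚ (ℤ.+ k) 0 (Coprime.sym (Coprime.1-coprimeTo k))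
  ℕtoℚ≡mkℚ k = normalize-coprime (Coprime.sym (Coprime.1-coprimeTo k))

  ℕtoℚ-suc : ∀ k → ℕtoℚ (ℕ.suc k) ≡ 1ℚ + ℕtoℚ k
  ℕtoℚ-suc k = toℚᵘ-injective (ℚᵘ.≃-trans suc≃ (ℚᵘ.≃-sym (toℚᵘ-homo-+ 1ℚ (ℕtoℚ k))))
    where
    suc≃ : toℚᵘ (ℕtoℚ (ℕ.suc k)) ℚᵘ.≃ toℚᵘ 1ℚ ℚᵘ.+ toℚᵘ (ℕtoℚ k)
    suc≃ rewrite ℕtoℚ≡mkℚ (ℕ.suc k) | ℕtoℚ≡mkℚ k =
      ℚᵘ.*≡* (trans (ℤ.*-identityʳ (ℤ.+ ℕ.suc k))
                    (sym (trans (ℤ.*-identityʳ _) (cong (ℤ._+_ (ℤ.+ 1)) (ℤ.*-identityʳ (ℤ.+ k))))))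

  ℕtoℚ-+ : ∀ a b → ℕtoℚ (a ℕ.+ b) ≡ ℕtoℚ a + ℕtoℚ b
  ℕtoℚ-+ ℕ.zero    b = sym (+-identityˡ (ℕtoℚ b))
  ℕtoℚ-+ (ℕ.suc a) b = begin
    ℕtoℚ (ℕ.suc (a ℕ.+ b))  ≡⟨ ℕtoℚ-suc (a ℕ.+ b) ⟩
    1ℚ + ℕtoℚ (a ℕ.+ b)     ≡⟨ cong (1ℚ +_) (ℕtoℚ-+ a b) ⟩
    1ℚ + (ℕtoℚ a + ℕtoℚ b)  ≡⟨ +-assoc 1ℚ (ℕtoℚ a) (ℕtoℚ b) ⟨
    (1ℚ + ℕtoℚ a) + ℕtoℚ b  ≡⟨ cong (_+ ℕtoℚ b) (ℕtoℚ-suc a) ⟨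
    ℕtoℚ (ℕ.suc a) + ℕtoℚ b ∎
    where open ≡-Reasoning

  ℕtoℚ-* : ∀ a b → ℕtoℚ (a ℕ.* b) ≡ ℕtoℚ a * ℕtoℚ b
  ℕtoℚ-* ℕ.zero    b = sym (*-zeroˡ (ℕtoℚ b))
  ℕtoℚ-* (ℕ.suc a) b = begin
    ℕtoℚ (b ℕ.+ a ℕ.* b)             ≡⟨ ℕtoℚ-+ b (a ℕ.* b) ⟩
    ℕtoℚ b + ℕtoℚ (a ℕ.* b)          ≡⟨ cong₂ _+_ (sym (*-identityˡ (ℕtoℚ b))) (ℕtoℚ-* a b) ⟩
    1ℚ * ℕtoℚ b + ℕtoℚ a * ℕtoℚ b    ≡⟨ *-distribʳ-+ (ℕtoℚ b) 1ℚ (ℕtoℚ a) ⟨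
    (1ℚ + ℕtoℚ a) * ℕtoℚ b           ≡⟨ cong (_* ℕtoℚ b) (ℕtoℚ-suc a) ⟨
    ℕtoℚ (ℕ.suc a) * ℕtoℚ b ∎
    where open ≡-Reasoning

  ℕtoℚ-nonNeg : ∀ k → NonNegative (ℕtoℚ k)
  ℕtoℚ-nonNeg k rewrite ℕtoℚ≡mkℚ k = _

  ℕtoℚ-mono-≤ : ∀ {a b} → a ℕ.≤ b → ℕtoℚ a ≤ ℕtoℚ b
  ℕtoℚ-mono-≤ {a} {b} a≤b = begin
    ℕtoℚ a                    ≡⟨ +-identityʳ (ℕtoℚ a) ⟨
    ℕtoℚ a + 0ℚ               ≤⟨ +-monoʳ-≤ (ℕtoℚ a) (nonNegative⁻¹ _ {{ℕtoℚ-nonNeg (b ℕ.∸ a)}}) ⟩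
    ℕtoℚ a + ℕtoℚ (b ℕ.∸ a)   ≡⟨ ℕtoℚ-+ a (b ℕ.∸ a) ⟨
    ℕtoℚ (a ℕ.+ (b ℕ.∸ a))    ≡⟨ cong ℕtoℚ (ℕ.m+[n∸m]≡n a≤b) ⟩
    ℕtoℚ b ∎
    where open ≤-Reasoning

  ℕtoℚ-invertible : ∀ k → 1 ℕ.≤ k → ∃ λ c → NonNegative c × c * ℕtoℚ k ≡ 1ℚ
  ℕtoℚ-invertible (ℕ.suc k) _ =
    1/ q , pos⇒nonNeg (1/ q) {{1/pos⇒pos q}} , *-inverseˡ q
    where
    q = ℕtoℚ (ℕ.suc k)
    instance
      q-pos : Positive q
      q-pos rewrite ℕtoℚ≡mkℚ (ℕ.suc k) = _
      q-nonZero : NonZero q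
      q-nonZero = pos⇒nonZero q

  sumℚ-cong : ∀ {m} {f g : Fin m → ℚ} → (∀ i → f i ≡ g i) → sumℚ f ≡ sumℚ g
  sumℚ-cong {ℕ.zero}  f≗g = refl
  sumℚ-cong {ℕ.suc m} f≗g = cong₂ _+_ (f≗g zero) (sumℚ-cong (λ i → f≗g (suc i)))

  sumℚ-zero : ∀ m → sumℚ {m} (λ _ → 0ℚ) ≡ 0ℚ
  sumℚ-zero ℕ.zero    = refl
  sumℚ-zero (ℕ.suc m) = trans (+-identityˡ _) (sumℚ-zero m)

  sumℚ-distrib-+ : ∀ {m} (f g : Fin m → ℚ) → sumℚ (λ i → f i + g i) ≡ sumℚ f + sumℚ g
  sumℚ-distrib-+ {ℕ.zero}  f g = sym (+-identityˡ 0ℚ)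
  sumℚ-distrib-+ {ℕ.suc m} f g =
    trans (cong ((f zero + g zero) +_) (sumℚ-distrib-+ (λ i → f (suc i)) (λ i → g (suc i))))
          (+-interchange (f zero) (g zero) (sumℚ (λ i → f (suc i))) (sumℚ (λ i → g (suc i))))

  sumℚ-neg : ∀ {m} (f : Fin m → ℚ) → sumℚ (λ i → - f i) ≡ - sumℚ f
  sumℚ-neg {ℕ.zero}  f = refl
  sumℚ-neg {ℕ.suc m} f = trans (cong (- f zero +_) (sumℚ-neg (λ i → f (suc i))))
                               (sym (neg-distrib-+ (f zero) (sumℚ (λ i → f (suc i)))))

  sumℚ-*ˡ : ∀ {m} c (f : Fin m → ℚ) → sumℚ (λ i → c * f i) ≡ c * sumℚ f
  sumℚ-*ˡ {ℕ.zero}  c f = sym (*-zeroʳ c)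
  sumℚ-*ˡ {ℕ.suc m} c f = trans (cong (c * f zero +_) (sumℚ-*ˡ c (λ i → f (suc i))))
                                (sym (*-distribˡ-+ c (f zero) (sumℚ (λ i → f (suc i)))))

  sumℚ-ℕtoℚ : ∀ {m} (f : Fin m → ℕ) → sumℚ (λ i → ℕtoℚ (f i)) ≡ ℕtoℚ (sumℕ f)
  sumℚ-ℕtoℚ {ℕ.zero}  f = refl
  sumℚ-ℕtoℚ {ℕ.suc m} f = trans (cong (ℕtoℚ (f zero) +_) (sumℚ-ℕtoℚ (λ i → f (suc i))))
                                (sym (ℕtoℚ-+ (f zero) (sumℕ (λ i → f (suc i)))))

  sumℚ-↑ : ∀ a b (f : Fin (a ℕ.+ b) → ℚ) → sumℚ f ≡ sumℚ (λ i → f (i ↑ˡ b)) + sumℚ (λ j → f (a ↑ʳ j))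
  sumℚ-↑ ℕ.zero    b f = sym (+-identityˡ (sumℚ f))
  sumℚ-↑ (ℕ.suc a) b f = trans (cong (f zero +_) (sumℚ-↑ a b (λ i → f (suc i))))
                               (sym (+-assoc (f zero) _ _))

  δ-suc : ∀ {m} (q p : Fin m) → δ {ℕ.suc m} (suc q) (suc p) ≡ δ q p
  δ-suc q p with q ≟ p
  ... | yes _ = refl
  ... | no _  = refl

  dot-δ : ∀ {m} (q : Fin m) (x : Fin m → ℚ) → dot (δ q) x ≡ x q
  dot-δ {ℕ.suc m} zero x = begin
    1ℚ * x zero + sumℚ (λ i → 0ℚ * x (suc i))
      ≡⟨ cong₂ _+_ (*-identityˡ (x zero)) (sumℚ-cong (λ i → *-zeroˡ (x (suc i)))) ⟩
    x zero + sumℚ {m} (λ _ → 0ℚ)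
      ≡⟨ trans (cong (x zero +_) (sumℚ-zero m)) (+-identityʳ (x zero)) ⟩
    x zero ∎
    where open ≡-Reasoning
  dot-δ {ℕ.suc m} (suc q) x = begin
    0ℚ * x zero + sumℚ (λ i → δ (suc q) (suc i) * x (suc i))
      ≡⟨ cong₂ _+_ (*-zeroˡ (x zero)) (sumℚ-cong (λ i → cong (_* x (suc i)) (δ-suc q i))) ⟩
    0ℚ + dot (δ q) (λ i → x (suc i))
      ≡⟨ trans (+-identityˡ _) (dot-δ q (λ i → x (suc i))) ⟩
    x (suc q) ∎
    where open ≡-Reasoning

  dot-distrib-+ : ∀ {m} (a b x : Fin m → ℚ) → dot (λ p → a p + b p) x ≡ dot a x + dot b x
  dot-distrib-+ a b x = trans (sumℚ-cong (λ p → *-distribʳ-+ (x p) (a p) (b p)))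
                              (sumℚ-distrib-+ (λ p → a p * x p) (λ p → b p * x p))

  dot-neg : ∀ {m} (a x : Fin m → ℚ) → dot (λ p → - a p) x ≡ - dot a x
  dot-neg a x = trans (sumℚ-cong (λ p → sym (neg-distribˡ-* (a p) (x p))))
                      (sumℚ-neg (λ p → a p * x p))

  signedSum-cong : ∀ {m} (N : Subset m) {f g : Subset m → ℚ} → (∀ T → f T ≡ g T) → signedSum N f ≡ signedSum N g
  signedSum-cong []          f≗g = f≗g []
  signedSum-cong (false ∷ N) f≗g = signedSum-cong N (λ T → f≗g (false ∷ T))
  signedSum-cong (true ∷ N)  f≗g =
    cong₂ _-_ (signedSum-cong N (λ T → f≗g (false ∷ T))) (signedSum-cong N (λ T → f≗g (true ∷ T)))

  signedSum-zero : ∀ {m} (N : Subset m) → signedSum N (λ _ → 0ℚ) ≡ 0ℚ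
  signedSum-zero []          = refl
  signedSum-zero (false ∷ N) = signedSum-zero N
  signedSum-zero (true ∷ N)  = cong₂ _-_ (signedSum-zero N) (signedSum-zero N)

  signedSum-distrib-+ : ∀ {m} (N : Subset m) (f g : Subset m → ℚ) →
    signedSum N (λ T → f T + g T) ≡ signedSum N f + signedSum N g
  signedSum-distrib-+ []          f g = refl
  signedSum-distrib-+ (false ∷ N) f g = signedSum-distrib-+ N (λ T → f (false ∷ T)) (λ T → g (false ∷ T))
  signedSum-distrib-+ (true ∷ N)  f g = begin
    signedSum N (λ T → f (false ∷ T) + g (false ∷ T)) - signedSum N (λ T → f (true ∷ T) + g (true ∷ T))
      ≡⟨ cong₂ _-_ (signedSum-distrib-+ N _ _) (signedSum-distrib-+ N _ _) ⟩
    (f₀ + g₀) - (f₁ + g₁)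
      ≡⟨ cong ((f₀ + g₀) +_) (neg-distrib-+ f₁ g₁) ⟩
    (f₀ + g₀) + (- f₁ + - g₁)
      ≡⟨ +-interchange f₀ g₀ (- f₁) (- g₁) ⟩
    (f₀ - f₁) + (g₀ - g₁) ∎
    where
    open ≡-Reasoning
    f₀ = signedSum N (λ T → f (false ∷ T))
    f₁ = signedSum N (λ T → f (true ∷ T))
    g₀ = signedSum N (λ T → g (false ∷ T))
    g₁ = signedSum N (λ T → g (true ∷ T))

  signedSum-*ˡ : ∀ {m} (N : Subset m) c (f : Subset m → ℚ) → signedSum N (λ T → c * f T) ≡ c * signedSum N f
  signedSum-*ˡ []          c f = refl
  signedSum-*ˡ (false ∷ N) c f = signedSum-*ˡ N c (λ T → f (false ∷ T))
  signedSum-*ˡ (true ∷ N)  c f = begin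
    signedSum N (λ T → c * f (false ∷ T)) - signedSum N (λ T → c * f (true ∷ T))
      ≡⟨ cong₂ _-_ (signedSum-*ˡ N c _) (signedSum-*ˡ N c _) ⟩
    c * f₀ - c * f₁      ≡⟨ cong (c * f₀ +_) (neg-distribʳ-* c f₁) ⟩
    c * f₀ + c * (- f₁)  ≡⟨ *-distribˡ-+ c f₀ (- f₁) ⟨
    c * (f₀ - f₁) ∎
    where
    open ≡-Reasoning
    f₀ = signedSum N (λ T → f (false ∷ T))
    f₁ = signedSum N (λ T → f (true ∷ T))

  signedSum-sumℚ : ∀ {m k} (N : Subset m) (f : Fin k → Subset m → ℚ) →
    signedSum N (λ T → sumℚ (λ j → f j T)) ≡ sumℚ (λ j → signedSum N (f j))
  signedSum-sumℚ {k = ℕ.zero}  N f = signedSum-zero N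
  signedSum-sumℚ {k = ℕ.suc k} N f =
    trans (signedSum-distrib-+ N (f zero) (λ T → sumℚ (λ j → f (suc j) T)))
          (cong (signedSum N (f zero) +_) (signedSum-sumℚ N (λ j → f (suc j))))

  𝟙ℚ : Bool → ℚ
  𝟙ℚ b = ℕtoℚ (𝟙 b)

  signedSum-⊆ᵇ : ∀ {m} (N B Z : Subset m) →
    signedSum N (λ T → 𝟙ℚ (B ∪ T ⊆ᵇ Z)) ≡ 𝟙ℚ ((B ⊆ᵇ Z) ∧ disjointᵇ N Z)
  signedSum-⊆ᵇ []          []          []          = refl
  signedSum-⊆ᵇ (false ∷ N) (false ∷ B) (z ∷ Z)     = signedSum-⊆ᵇ N B Z
  signedSum-⊆ᵇ (false ∷ N) (true ∷ B)  (true ∷ Z)  = signedSum-⊆ᵇ N B Z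
  signedSum-⊆ᵇ (false ∷ N) (true ∷ B)  (false ∷ Z) = signedSum-zero N
  signedSum-⊆ᵇ (true ∷ N)  (false ∷ B) (false ∷ Z) =
    trans (cong₂ _-_ (signedSum-⊆ᵇ N B Z) (signedSum-zero N)) (+-identityʳ _)
  signedSum-⊆ᵇ (true ∷ N)  (false ∷ B) (true ∷ Z)  =
    trans (cong₂ _-_ (signedSum-⊆ᵇ N B Z) (signedSum-⊆ᵇ N B Z))
          (trans (+-inverseʳ (𝟙ℚ ((B ⊆ᵇ Z) ∧ disjointᵇ N Z))) (cong 𝟙ℚ (sym (∧-zeroʳ (B ⊆ᵇ Z)))))
  signedSum-⊆ᵇ (true ∷ N)  (true ∷ B)  (false ∷ Z) = cong₂ _-_ (signedSum-zero N) (signedSum-zero N)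
  signedSum-⊆ᵇ (true ∷ N)  (true ∷ B)  (true ∷ Z)  =
    trans (cong₂ _-_ (signedSum-⊆ᵇ N B Z) (signedSum-⊆ᵇ N B Z))
          (trans (+-inverseʳ (𝟙ℚ ((B ⊆ᵇ Z) ∧ disjointᵇ N Z))) (cong 𝟙ℚ (sym (∧-zeroʳ (B ⊆ᵇ Z)))))

  ℕtoℚ-sumℕ-* : ∀ {k} (f g : Fin k → ℕ) →
    ℕtoℚ (sumℕ (λ j → f j ℕ.* g j)) ≡ sumℚ (λ j → ℕtoℚ (f j) * ℕtoℚ (g j))
  ℕtoℚ-sumℕ-* f g = trans (sym (sumℚ-ℕtoℚ (λ j → f j ℕ.* g j))) (sumℚ-cong (λ j → ℕtoℚ-* (f j) (g j)))

-- y = c · Σ_j w_j [S ⊆ Z_j] is the moment vector of a nonnegative combination of integral points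
-- Z_j; each of its Sherali–Adams columns is again such a combination, with w_j restricted to the
-- points satisfying Y ⊆ Z_j and N ∩ Z_j = ∅.
module Mixtures where

  import Data.Nat.Properties as ℕ
  open import Data.Rational using (ℚ; _*_)
  open import Data.Bool.Properties using (∧-assoc; ∧-comm)
  open import Data.Fin.Subset.Properties using (∪-assoc)
  open Counting
  open Rationals

  mass : ∀ {m k} → (Fin k → ℕ) → (Fin k → Subset m) → Subset m → ℕ
  mass w Z S = sumℕ (λ j → w j ℕ.* 𝟙 (S ⊆ᵇ Z j))

  condition : ∀ {m k} → (Fin k → ℕ) → (Fin k → Subset m) → Subset m → Subset m → Fin k → ℕ
  condition w Z Y N j = w j ℕ.* 𝟙 ((Y ⊆ᵇ Z j) ∧ disjointᵇ N (Z j))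

  momentCol-mass : ∀ {m k} (c : ℚ) (w : Fin k → ℕ) (Z : Fin k → Subset m) Y N A →
    momentCol (λ S → c * ℕtoℚ (mass w Z S)) Y N A ≡ c * ℕtoℚ (mass (condition w Z Y N) Z A)
  momentCol-mass c w Z Y N A = begin
    signedSum N (λ T → c * ℕtoℚ (mass w Z (A ∪ (Y ∪ T))))
      ≡⟨ signedSum-*ˡ N c _ ⟩
    c * signedSum N (λ T → ℕtoℚ (mass w Z (A ∪ (Y ∪ T))))
      ≡⟨ cong (c *_) (signedSum-cong N (λ T → cong (ℕtoℚ ∘ mass w Z) (sym (∪-assoc A Y T)))) ⟩
    c * signedSum N (λ T → ℕtoℚ (mass w Z (B ∪ T)))
      ≡⟨ cong (c *_) (signedSum-cong N (λ T → ℕtoℚ-sumℕ-* w (λ j → 𝟙 (B ∪ T ⊆ᵇ Z j)))) ⟩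
    c * signedSum N (λ T → sumℚ (λ j → ℕtoℚ (w j) * 𝟙ℚ (B ∪ T ⊆ᵇ Z j)))
      ≡⟨ cong (c *_) (signedSum-sumℚ N (λ j T → ℕtoℚ (w j) * 𝟙ℚ (B ∪ T ⊆ᵇ Z j))) ⟩
    c * sumℚ (λ j → signedSum N (λ T → ℕtoℚ (w j) * 𝟙ℚ (B ∪ T ⊆ᵇ Z j)))
      ≡⟨ cong (c *_) (sumℚ-cong (λ j → trans (signedSum-*ˡ N (ℕtoℚ (w j)) _)
                                             (cong (ℕtoℚ (w j) *_) (signedSum-⊆ᵇ N B (Z j))))) ⟩
    c * sumℚ (λ j → ℕtoℚ (w j) * 𝟙ℚ ((B ⊆ᵇ Z j) ∧ disjointᵇ N (Z j)))
      ≡⟨ cong (c *_) (ℕtoℚ-sumℕ-* w (λ j → 𝟙 ((B ⊆ᵇ Z j) ∧ disjointᵇ N (Z j)))) ⟨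
    c * ℕtoℚ (sumℕ (λ j → w j ℕ.* 𝟙 ((B ⊆ᵇ Z j) ∧ disjointᵇ N (Z j))))
      ≡⟨ cong (λ k → c * ℕtoℚ k) (sumℕ-cong regroup) ⟩
    c * ℕtoℚ (mass (condition w Z Y N) Z A) ∎
    where
    open ≡-Reasoning
    open import Function using (_∘_)
    B = A ∪ Y
    regroup : ∀ j → w j ℕ.* 𝟙 ((B ⊆ᵇ Z j) ∧ disjointᵇ N (Z j)) ≡ condition w Z Y N j ℕ.* 𝟙 (A ⊆ᵇ Z j)
    regroup j = begin
      w j ℕ.* 𝟙 ((B ⊆ᵇ Z j) ∧ d)                  ≡⟨ cong (λ b → w j ℕ.* 𝟙 (b ∧ d)) (∪-⊆ᵇ A Y (Z j)) ⟩
      w j ℕ.* 𝟙 (((A ⊆ᵇ Z j) ∧ (Y ⊆ᵇ Z j)) ∧ d)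
        ≡⟨ cong (λ b → w j ℕ.* 𝟙 b) (trans (∧-assoc (A ⊆ᵇ Z j) _ d) (∧-comm (A ⊆ᵇ Z j) _)) ⟩
      w j ℕ.* 𝟙 (((Y ⊆ᵇ Z j) ∧ d) ∧ (A ⊆ᵇ Z j))   ≡⟨ cong (w j ℕ.*_) (𝟙-∧ ((Y ⊆ᵇ Z j) ∧ d) (A ⊆ᵇ Z j)) ⟩
      w j ℕ.* (𝟙 ((Y ⊆ᵇ Z j) ∧ d) ℕ.* 𝟙 (A ⊆ᵇ Z j)) ≡⟨ ℕ.*-assoc (w j) _ _ ⟨
      condition w Z Y N j ℕ.* 𝟙 (A ⊆ᵇ Z j) ∎
      where d = disjointᵇ N (Z j)

  mass-⊥ : ∀ {m k} (w : Fin k → ℕ) (Z : Fin k → Subset m) → mass w Z ⊥ ≡ sumℕ w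
  mass-⊥ w Z = sumℕ-cong (λ j → trans (cong (λ b → w j ℕ.* 𝟙 b) (⊥⊆ᵇ (Z j))) (ℕ.*-identityʳ (w j)))

  mass-⁅⁆ : ∀ {m k} (w : Fin k → ℕ) (Z : Fin k → Subset m) p →
    mass w Z ⁅ p ⁆ ≡ sumℕ (λ j → w j ℕ.* 𝟙 (lookup (Z j) p))
  mass-⁅⁆ w Z p = sumℕ-cong (λ j → cong (λ b → w j ℕ.* 𝟙 b) (⁅⁆⊆ᵇ p (Z j)))

  mass-⁅⁆≤mass-⊥ : ∀ {m k} (w : Fin k → ℕ) (Z : Fin k → Subset m) p → mass w Z ⁅ p ⁆ ℕ.≤ mass w Z ⊥
  mass-⁅⁆≤mass-⊥ w Z p = begin
    mass w Z ⁅ p ⁆                             ≡⟨ mass-⁅⁆ w Z p ⟩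
    sumℕ (λ j → w j ℕ.* 𝟙 (lookup (Z j) p))   ≤⟨ sumℕ-mono (λ j → ℕ.≤-trans (ℕ.≤-reflexive (ℕ.*-comm (w j) _))
                                                                            (𝟙*-≤ (lookup (Z j) p) (w j))) ⟩
    sumℕ w                                     ≡⟨ mass-⊥ w Z ⟨
    mass w Z ⊥ ∎
    where open ℕ.≤-Reasoning

module PartialVertexCoverCone where

  open import Data.Rational using (ℚ; 0ℚ; 1ℚ; _+_; _*_; _-_; -_; _≤_; NonNegative)
  open import Data.Rational.Properties hiding (_≟_)
  import Data.Fin.Properties as Fin
  open import Data.List.Relation.Unary.All using (_∷_)
  import Data.List.Relation.Unary.All as All
  open import Data.List.Relation.Unary.All.Properties using (++⁺; map⁺; tabulate⁺)
  open Rationals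

  scaled-mono : ∀ c .{{_ : NonNegative c}} {u w} → u ℕ.≤ w → c * ℕtoℚ u ≤ c * ℕtoℚ w
  scaled-mono c u≤w = *-monoˡ-≤-nonNeg c (ℕtoℚ-mono-≤ u≤w)

  scaled-+ : ∀ c u w → c * ℕtoℚ u + c * ℕtoℚ w ≡ c * ℕtoℚ (u ℕ.+ w)
  scaled-+ c u w = trans (sym (*-distribˡ-+ c (ℕtoℚ u) (ℕtoℚ w))) (cong (c *_) (sym (ℕtoℚ-+ u w)))

  scaled-ratio≤ : ∀ c .{{_ : NonNegative c}} D {u w} → c * ℕtoℚ D ≡ 1ℚ → u ℕ.≤ D ℕ.* w → c * ℕtoℚ u ≤ ℕtoℚ w
  scaled-ratio≤ c D {u} {w} c*D≡1 u≤Dw = begin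
    c * ℕtoℚ u               ≤⟨ scaled-mono c u≤Dw ⟩
    c * ℕtoℚ (D ℕ.* w)       ≡⟨ cong (c *_) (ℕtoℚ-* D w) ⟩
    c * (ℕtoℚ D * ℕtoℚ w)    ≡⟨ *-assoc c (ℕtoℚ D) (ℕtoℚ w) ⟨
    c * ℕtoℚ D * ℕtoℚ w      ≡⟨ trans (cong (_* ℕtoℚ w) c*D≡1) (*-identityˡ (ℕtoℚ w)) ⟩
    ℕtoℚ w ∎
    where open ≤-Reasoning

  scaled-* : ∀ c u w → ℕtoℚ u * (c * ℕtoℚ w) ≡ c * ℕtoℚ (u ℕ.* w)
  scaled-* c u w = begin
    ℕtoℚ u * (c * ℕtoℚ w)  ≡⟨ *-assoc (ℕtoℚ u) c (ℕtoℚ w) ⟨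
    ℕtoℚ u * c * ℕtoℚ w    ≡⟨ cong (_* ℕtoℚ w) (*-comm (ℕtoℚ u) c) ⟩
    c * ℕtoℚ u * ℕtoℚ w    ≡⟨ *-assoc c (ℕtoℚ u) (ℕtoℚ w) ⟩
    c * (ℕtoℚ u * ℕtoℚ w)  ≡⟨ cong (c *_) (ℕtoℚ-* u w) ⟨
    c * ℕtoℚ (u ℕ.* w) ∎
    where open ≡-Reasoning

  dot-isEdge : ∀ (G : Graph) (x : Fin (groundSize G) → ℚ) → dot (isEdge G) x ≡ sumℚ (λ e → x (edg G e))
  dot-isEdge G x = begin
    dot (isEdge G) x
      ≡⟨ sumℚ-↑ (nV G) (nE G) (λ p → isEdge G p * x p) ⟩
    sumℚ (λ i → isEdge G (vtx G i) * x (vtx G i)) + sumℚ (λ e → isEdge G (edg G e) * x (edg G e))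
      ≡⟨ cong₂ _+_ (trans (sumℚ-cong (λ i → trans (cong (_* x (vtx G i)) (isEdge-vtx i)) (*-zeroˡ (x (vtx G i)))))
                          (sumℚ-zero (nV G)))
                   (sumℚ-cong (λ e → trans (cong (_* x (edg G e)) (isEdge-edg e)) (*-identityˡ _))) ⟩
    0ℚ + sumℚ (λ e → x (edg G e))
      ≡⟨ +-identityˡ _ ⟩
    sumℚ (λ e → x (edg G e)) ∎
    where
    open ≡-Reasoning
    isEdge-vtx : ∀ i → isEdge G (vtx G i) ≡ 0ℚ
    isEdge-vtx i rewrite Fin.splitAt-↑ˡ (nV G) i (nE G) = refl
    isEdge-edg : ∀ e → isEdge G (edg G e) ≡ 1ℚ
    isEdge-edg e rewrite Fin.splitAt-↑ʳ (nV G) (nE G) e = refl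

  inCone-cong : ∀ {m} (sys : LinSystem m) {z z′ : ℚ} {x x′ : Fin m → ℚ} →
    z ≡ z′ → (∀ p → x p ≡ x′ p) → InCone sys z x → InCone sys z′ x′
  inCone-cong sys refl x≗x′ (0≤z , satisfied) =
    0≤z , All.map (λ {con} → subst (rhs con * _ ≤_) (sumℚ-cong (λ p → cong (coef con p *_) (x≗x′ p)))) satisfied

  dot-edgeCoef : ∀ {m} (i j b : Fin m) (x : Fin m → ℚ) → dot (λ p → δ i p + δ j p - δ b p) x ≡ x i + x j - x b
  dot-edgeCoef i j b x = begin
    dot (λ p → δ i p + δ j p - δ b p) x
      ≡⟨ dot-distrib-+ (λ p → δ i p + δ j p) (λ p → - δ b p) x ⟩
    dot (λ p → δ i p + δ j p) x + dot (λ p → - δ b p) x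
      ≡⟨ cong₂ _+_ (dot-distrib-+ (δ i) (δ j) x) (dot-neg (δ b) x) ⟩
    dot (δ i) x + dot (δ j) x - dot (δ b) x
      ≡⟨ cong₂ _-_ (cong₂ _+_ (dot-δ i x) (dot-δ j x)) (dot-δ b x) ⟩
    x i + x j - x b ∎
    where open ≡-Reasoning

  inCone-PVCSystem : ∀ (G : Graph) t (z : ℚ) (x : Fin (groundSize G) → ℚ) → 0ℚ ≤ z →
    (∀ e → x (edg G e) ≤ x (vtx G (proj₁ (ends G e))) + x (vtx G (proj₂ (ends G e)))) →
    (∀ q → 0ℚ ≤ x q) → (∀ q → x q ≤ z) → ℕtoℚ t * z ≤ sumℚ (λ e → x (edg G e)) →
    InCone (PVCSystem G t) z x
  inCone-PVCSystem G t z x 0≤z edge≤ 0≤x x≤z cover =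
    0≤z , ++⁺ (map⁺ (tabulate⁺ edgeP)) (coverP ∷ ++⁺ (map⁺ (tabulate⁺ lowerP)) (map⁺ (tabulate⁺ upperP)))
    where
    open ≤-Reasoning
    edgeP : ∀ e → 0ℚ * z ≤ dot (λ p → δ (vtx G (proj₁ (ends G e))) p + δ (vtx G (proj₂ (ends G e))) p - δ (edg G e) p) x
    edgeP e = begin
      0ℚ * z                     ≡⟨ trans (*-zeroˡ z) (sym (+-inverseʳ (x (edg G e)))) ⟩
      x (edg G e) - x (edg G e)  ≤⟨ +-monoˡ-≤ (- x (edg G e)) (edge≤ e) ⟩
      x i + x j - x (edg G e)    ≡⟨ dot-edgeCoef i j (edg G e) x ⟨
      dot (λ p → δ i p + δ j p - δ (edg G e) p) x ∎
      where
      i = vtx G (proj₁ (ends G e))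
      j = vtx G (proj₂ (ends G e))

    coverP : ℕtoℚ t * z ≤ dot (isEdge G) x
    coverP = ≤-trans cover (≤-reflexive (sym (dot-isEdge G x)))

    lowerP : ∀ q → 0ℚ * z ≤ dot (δ q) x
    lowerP q = begin
      0ℚ * z        ≡⟨ *-zeroˡ z ⟩
      0ℚ            ≤⟨ 0≤x q ⟩
      x q           ≡⟨ dot-δ q x ⟨
      dot (δ q) x ∎

    upperP : ∀ q → - 1ℚ * z ≤ dot (λ p → - δ q p) x
    upperP q = begin
      - 1ℚ * z              ≡⟨ trans (sym (neg-distribˡ-* 1ℚ z)) (cong -_ (*-identityˡ z)) ⟩
      - z                   ≤⟨ neg-antimono-≤ (x≤z q) ⟩
      - x q                 ≡⟨ trans (cong -_ (sym (dot-δ q x))) (sym (dot-neg (δ q) x)) ⟩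
      dot (λ p → - δ q p) x ∎

  inCone-PVCSystem-scaled : ∀ (G : Graph) t c .{{_ : NonNegative c}} (total : ℕ) (marginal : Fin (groundSize G) → ℕ) →
    (∀ e → marginal (edg G e) ℕ.≤ marginal (vtx G (proj₁ (ends G e))) ℕ.+ marginal (vtx G (proj₂ (ends G e)))) →
    (∀ q → marginal q ℕ.≤ total) →
    t ℕ.* total ℕ.≤ sumℕ (λ e → marginal (edg G e)) →
    InCone (PVCSystem G t) (c * ℕtoℚ total) (λ p → c * ℕtoℚ (marginal p))
  inCone-PVCSystem-scaled G t c total marginal edge≤ marginal≤total cover =
    inCone-PVCSystem G t (c * ℕtoℚ total) x (scaled-nonNeg total)
      (λ e → ≤-trans (scaled-mono c (edge≤ e))
                     (≤-reflexive (sym (scaled-+ c (marginal (vtx G (proj₁ (ends G e))))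
                                                   (marginal (vtx G (proj₂ (ends G e))))))))
      (λ q → scaled-nonNeg (marginal q))
      (λ q → scaled-mono c (marginal≤total q))
      (begin
        ℕtoℚ t * (c * ℕtoℚ total)                   ≡⟨ scaled-* c t total ⟩
        c * ℕtoℚ (t ℕ.* total)                       ≤⟨ scaled-mono c cover ⟩
        c * ℕtoℚ (sumℕ (λ e → marginal (edg G e)))  ≡⟨ cong (c *_) (sumℚ-ℕtoℚ (λ e → marginal (edg G e))) ⟨
        c * sumℚ (λ e → ℕtoℚ (marginal (edg G e)))  ≡⟨ sumℚ-*ˡ c (λ e → ℕtoℚ (marginal (edg G e))) ⟨
        sumℚ (λ e → x (edg G e)) ∎)
    where
    open ≤-Reasoning
    x : Fin (groundSize G) → ℚ
    x p = c * ℕtoℚ (marginal p)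
    scaled-nonNeg : ∀ k → 0ℚ ≤ c * ℕtoℚ k
    scaled-nonNeg k = nonNegative⁻¹ (c * ℕtoℚ k) {{nonNeg*nonNeg⇒nonNeg c (ℕtoℚ k) {{ℕtoℚ-nonNeg k}}}}

module Stars where

  open import Data.Nat hiding (_≟_)
  open import Data.Nat.Properties hiding (_≟_)
  open import Data.Fin using (splitAt; join)
  import Data.Fin.Properties as Fin
  open import Data.Sum using (inj₁; inj₂; [_,_]′)
  open import Data.Vec using (tabulate)
  open import Data.Vec.Properties using (lookup∘tabulate)
  open Counting
  open Degrees using (incident; degree)

  memberOfStar : (G : Graph) → Fin (nV G) → Fin (groundSize G) → Bool
  memberOfStar G v p = [ (λ u → ⌊ u ≟ v ⌋) , incident G v ]′ (splitAt (nV G) p)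

  star : (G : Graph) → Fin (nV G) → Subset (groundSize G)
  star G v = tabulate (memberOfStar G v)

  EdgeClosed : (G : Graph) → Subset (groundSize G) → Set
  EdgeClosed G Z = ∀ e → 𝟙 (lookup Z (edg G e))
                         ≤ 𝟙 (lookup Z (vtx G (proj₁ (ends G e)))) + 𝟙 (lookup Z (vtx G (proj₂ (ends G e))))

  module _ (G : Graph) where

    lookup-star-vtx : ∀ v i → lookup (star G v) (vtx G i) ≡ ⌊ i ≟ v ⌋
    lookup-star-vtx v i = trans (lookup∘tabulate (memberOfStar G v) (vtx G i))
                                (cong [ (λ u → ⌊ u ≟ v ⌋) , incident G v ]′ (Fin.splitAt-↑ˡ (nV G) i (nE G)))

    lookup-star-edg : ∀ v e → lookup (star G v) (edg G e) ≡ incident G v e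
    lookup-star-edg v e = trans (lookup∘tabulate (memberOfStar G v) (edg G e))
                                (cong [ (λ u → ⌊ u ≟ v ⌋) , incident G v ]′ (Fin.splitAt-↑ʳ (nV G) (nE G) e))

    ⊥-edgeClosed : EdgeClosed G ⊥
    ⊥-edgeClosed e rewrite lookup-⊥ (edg G e) = z≤n

    star-edgeClosed : ∀ v → EdgeClosed G (star G v)
    star-edgeClosed v e rewrite lookup-star-edg v e | lookup-star-vtx v (proj₁ (ends G e)) | lookup-star-vtx v (proj₂ (ends G e)) =
      𝟙-∨ ⌊ proj₁ (ends G e) ≟ v ⌋ ⌊ proj₂ (ends G e) ≟ v ⌋

    stars-through-vtx : ∀ i → sumℕ (λ v → 𝟙 (lookup (star G v) (vtx G i))) ≡ 1
    stars-through-vtx i = trans (sumℕ-cong (λ v → cong 𝟙 (lookup-star-vtx v i))) (sumℕ-𝟙≟ i)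

    edges-in-star : ∀ v → sumℕ (λ e → 𝟙 (lookup (star G v) (edg G e))) ≡ degree G v
    edges-in-star v = sumℕ-cong (λ e → cong 𝟙 (lookup-star-edg v e))

    stars-through≤2 : ∀ p → sumℕ (λ v → 𝟙 (lookup (star G v) p)) ≤ 2
    stars-through≤2 p = subst (λ q → sumℕ (λ v → 𝟙 (lookup (star G v) q)) ≤ 2)
                              (Fin.join-splitAt (nV G) (nE G) p) (by-kind (splitAt (nV G) p))
      where
      by-kind : ∀ w → sumℕ (λ v → 𝟙 (lookup (star G v) (join (nV G) (nE G) w))) ≤ 2
      by-kind (inj₁ i) = ≤-trans (≤-reflexive (stars-through-vtx i)) (s≤s z≤n)
      by-kind (inj₂ e) = begin
        sumℕ (λ v → 𝟙 (lookup (star G v) (edg G e)))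
          ≡⟨ sumℕ-cong (λ v → cong 𝟙 (lookup-star-edg v e)) ⟩
        sumℕ (λ v → 𝟙 (⌊ i ≟ v ⌋ ∨ ⌊ j ≟ v ⌋))
          ≤⟨ sumℕ-mono (λ v → 𝟙-∨ ⌊ i ≟ v ⌋ ⌊ j ≟ v ⌋) ⟩
        sumℕ (λ v → 𝟙 ⌊ i ≟ v ⌋ + 𝟙 ⌊ j ≟ v ⌋)
          ≡⟨ trans (sumℕ-distrib-+ (λ v → 𝟙 ⌊ i ≟ v ⌋) (λ v → 𝟙 ⌊ j ≟ v ⌋))
                   (cong₂ _+_ (sumℕ-𝟙≟ i) (sumℕ-𝟙≟ j)) ⟩
        2 ∎
        where
        open ≤-Reasoning
        i = proj₁ (ends G e)
        j = proj₂ (ends G e)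

    stars-avoiding : ∀ N → nV G ∸ 2 * ∣ N ∣ ≤ sumℕ (λ v → 𝟙 (disjointᵇ N (star G v)))
    stars-avoiding N = begin
      nV G ∸ 2 * ∣ N ∣                                  ≤⟨ ∸-monoˡ-≤ (2 * ∣ N ∣) n≤ ⟩
      avoiding + 2 * ∣ N ∣ ∸ 2 * ∣ N ∣                   ≡⟨ m+n∸n≡m avoiding (2 * ∣ N ∣) ⟩
      avoiding ∎
      where
      open ≤-Reasoning
      avoiding = sumℕ (λ v → 𝟙 (disjointᵇ N (star G v)))
      n≤ : nV G ≤ avoiding + 2 * ∣ N ∣
      n≤ = begin
        nV G                      ≡⟨ trans (sym (*-identityʳ (nV G))) (sym (sumℕ-const (nV G) 1)) ⟩
        sumℕ {nV G} (λ _ → 1)    ≡⟨ sumℕ-cong (λ v → sym (𝟙+𝟙-not (disjointᵇ N (star G v)))) ⟩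
        sumℕ (λ v → 𝟙 (disjointᵇ N (star G v)) + 𝟙 (not (disjointᵇ N (star G v))))
          ≡⟨ sumℕ-distrib-+ (λ v → 𝟙 (disjointᵇ N (star G v))) _ ⟩
        avoiding + sumℕ (λ v → 𝟙 (not (disjointᵇ N (star G v))))
          ≤⟨ +-monoʳ-≤ avoiding (meeting-count≤ 2 (star G) stars-through≤2 N) ⟩
        avoiding + 2 * ∣ N ∣ ∎

module StarMixture (G : Graph) (r t d : ℕ) (t≤d : t ℕ.≤ d) (d≤degree : ∀ v → d ℕ.≤ Degrees.degree G v) where

  open import Data.Nat hiding (_≟_)
  open import Data.Nat.Properties hiding (_≟_)
  open import Data.Fin.Subset.Properties using (∣q∣≤∣p∪q∣)
  open Counting
  open Degrees using (degree)
  open Stars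
  open Mixtures
  open Rationals using (sumℚ-cong; sumℚ-*ˡ; sumℚ-ℕtoℚ)
  open PartialVertexCoverCone using (inCone-cong; inCone-PVCSystem-scaled)
  import Data.Rational as ℚ
  open ℚ using (ℚ; 1ℚ)

  s a : ℕ
  s = nV G ∸ 2 * r
  a = s * (d ∸ t)

  points : Fin (suc (nV G)) → Subset (groundSize G)
  points zero    = ⊥
  points (suc v) = star G v

  weights : Fin (suc (nV G)) → ℕ
  weights zero    = a
  weights (suc v) = t

  points-edgeClosed : ∀ k → EdgeClosed G (points k)
  points-edgeClosed zero    = ⊥-edgeClosed G
  points-edgeClosed (suc v) = star-edgeClosed G v

  marginal-edge≤ : ∀ (w : Fin (suc (nV G)) → ℕ) e →
    mass w points ⁅ edg G e ⁆ ≤ mass w points ⁅ vtx G (proj₁ (ends G e)) ⁆ + mass w points ⁅ vtx G (proj₂ (ends G e)) ⁆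
  marginal-edge≤ w e = begin
    mass w points ⁅ edg G e ⁆
      ≡⟨ mass-⁅⁆ w points (edg G e) ⟩
    sumℕ (λ k → w k * 𝟙 (lookup (points k) (edg G e)))
      ≤⟨ sumℕ-mono (λ k → *-monoʳ-≤ (w k) (points-edgeClosed k e)) ⟩
    sumℕ (λ k → w k * (𝟙 (lookup (points k) i) + 𝟙 (lookup (points k) j)))
      ≡⟨ sumℕ-cong (λ k → *-distribˡ-+ (w k) (𝟙 (lookup (points k) i)) (𝟙 (lookup (points k) j))) ⟩
    sumℕ (λ k → w k * 𝟙 (lookup (points k) i) + w k * 𝟙 (lookup (points k) j))
      ≡⟨ sumℕ-distrib-+ (λ k → w k * 𝟙 (lookup (points k) i)) (λ k → w k * 𝟙 (lookup (points k) j)) ⟩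
    sumℕ (λ k → w k * 𝟙 (lookup (points k) i)) + sumℕ (λ k → w k * 𝟙 (lookup (points k) j))
      ≡⟨ cong₂ _+_ (mass-⁅⁆ w points i) (mass-⁅⁆ w points j) ⟨
    mass w points ⁅ i ⁆ + mass w points ⁅ j ⁆ ∎
    where
    open ≤-Reasoning
    i = vtx G (proj₁ (ends G e))
    j = vtx G (proj₂ (ends G e))

  degree-weighted≤edge-marginals : ∀ (w : Fin (suc (nV G)) → ℕ) →
    sumℕ (λ v → w (suc v) * degree G v) ≤ sumℕ (λ e → mass w points ⁅ edg G e ⁆)
  degree-weighted≤edge-marginals w = begin
    sumℕ (λ v → w (suc v) * degree G v)
      ≡⟨ sumℕ-cong (λ v → cong (w (suc v) *_) (edges-in-star G v)) ⟨
    sumℕ (λ v → w (suc v) * inPoint (suc v))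
      ≤⟨ m≤n+m _ (w zero * inPoint zero) ⟩
    sumℕ (λ k → w k * inPoint k)
      ≡⟨ sumℕ-cong (λ k → sumℕ-*ˡ (w k) (λ e → 𝟙 (lookup (points k) (edg G e)))) ⟨
    sumℕ (λ k → sumℕ (λ e → w k * 𝟙 (lookup (points k) (edg G e))))
      ≡⟨ sumℕ-comm (λ k e → w k * 𝟙 (lookup (points k) (edg G e))) ⟩
    sumℕ (λ e → sumℕ (λ k → w k * 𝟙 (lookup (points k) (edg G e))))
      ≡⟨ sumℕ-cong (λ e → mass-⁅⁆ w points (edg G e)) ⟨
    sumℕ (λ e → mass w points ⁅ edg G e ⁆) ∎
    where
    open ≤-Reasoning
    inPoint : Fin (suc (nV G)) → ℕ
    inPoint k = sumℕ (λ e → 𝟙 (lookup (points k) (edg G e)))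

  vertex-marginal : ∀ i → mass weights points ⁅ vtx G i ⁆ ≡ t
  vertex-marginal i = begin
    mass weights points ⁅ vtx G i ⁆
      ≡⟨ mass-⁅⁆ weights points (vtx G i) ⟩
    a * 𝟙 (lookup ⊥ (vtx G i)) + sumℕ (λ v → t * 𝟙 (lookup (star G v) (vtx G i)))
      ≡⟨ cong₂ _+_ (trans (cong (λ b → a * 𝟙 b) (lookup-⊥ (vtx G i))) (*-zeroʳ a))
                   (trans (sumℕ-*ˡ t (λ v → 𝟙 (lookup (star G v) (vtx G i)))) (cong (t *_) (stars-through-vtx G i))) ⟩
    t * 1
      ≡⟨ *-identityʳ t ⟩
    t ∎
    where open ≡-Reasoning

  alive : Subset (groundSize G) → Subset (groundSize G) → Fin (nV G) → Bool
  alive Y N v = (Y ⊆ᵇ star G v) ∧ disjointᵇ N (star G v)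

  aliveStars : Subset (groundSize G) → Subset (groundSize G) → ℕ
  aliveStars Y N = sumℕ (λ v → 𝟙 (alive Y N v))

  s≤aliveStars : ∀ Y N → Y ⊆ᵇ ⊥ ≡ true → ∣ Y ∪ N ∣ ≤ r → s ≤ aliveStars Y N
  s≤aliveStars Y N Y⊆⊥ ∣Y∪N∣≤r = begin
    nV G ∸ 2 * r                                    ≤⟨ ∸-monoʳ-≤ (nV G) (*-monoʳ-≤ 2 (≤-trans (∣q∣≤∣p∪q∣ Y N) ∣Y∪N∣≤r)) ⟩
    nV G ∸ 2 * ∣ N ∣                                ≤⟨ stars-avoiding G N ⟩
    sumℕ (λ v → 𝟙 (disjointᵇ N (star G v)))        ≡⟨ sumℕ-cong (λ v → cong (λ b → 𝟙 (b ∧ disjointᵇ N (star G v))) Y⊆star) ⟨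
    aliveStars Y N ∎
    where
    open ≤-Reasoning
    Y⊆star : ∀ {v} → Y ⊆ᵇ star G v ≡ true
    Y⊆star {v} = trans (cong (_⊆ᵇ star G v) (⊆ᵇ⊥⇒≡⊥ Y Y⊆⊥)) (⊥⊆ᵇ (star G v))

  -- The mass a of the empty cover is paid for by the at least s stars that survive when Y = ∅.
  base-weight≤ : ∀ Y N → ∣ Y ∪ N ∣ ≤ r → condition weights points Y N zero + t * aliveStars Y N ≤ d * aliveStars Y N
  base-weight≤ Y N ∣Y∪N∣≤r with Y ⊆ᵇ ⊥ in Y⊆⊥
  ... | false = begin
    a * 0 + t * A  ≡⟨ cong (_+ t * A) (*-zeroʳ a) ⟩
    t * A          ≤⟨ *-monoˡ-≤ A t≤d ⟩
    d * A ∎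
    where
    open ≤-Reasoning
    A = aliveStars Y N
  ... | true rewrite disjointᵇ-⊥ N = begin
    a * 1 + t * A              ≡⟨ cong (_+ t * A) (*-identityʳ a) ⟩
    s * (d ∸ t) + t * A        ≤⟨ +-monoˡ-≤ (t * A) (*-monoˡ-≤ (d ∸ t) (s≤aliveStars Y N Y⊆⊥ ∣Y∪N∣≤r)) ⟩
    A * (d ∸ t) + t * A        ≡⟨ cong (_+ t * A) (*-comm A (d ∸ t)) ⟩
    (d ∸ t) * A + t * A        ≡⟨ *-distribʳ-+ A (d ∸ t) t ⟨
    (d ∸ t + t) * A            ≡⟨ cong (_* A) (m∸n+n≡m t≤d) ⟩
    d * A ∎
    where
    open ≤-Reasoning
    A = aliveStars Y N

  cover≤ : ∀ Y N → ∣ Y ∪ N ∣ ≤ r →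
    t * mass (condition weights points Y N) points ⊥ ≤ sumℕ (λ e → mass (condition weights points Y N) points ⁅ edg G e ⁆)
  cover≤ Y N ∣Y∪N∣≤r = begin
    t * mass w′ points ⊥                 ≡⟨ cong (t *_) (mass-⊥ w′ points) ⟩
    t * (w′ zero + sumℕ W)               ≡⟨ cong (λ k → t * (w′ zero + k)) (sumℕ-*ˡ t (λ v → 𝟙 (alive Y N v))) ⟩
    t * (w′ zero + t * A)                ≤⟨ *-monoʳ-≤ t (base-weight≤ Y N ∣Y∪N∣≤r) ⟩
    t * (d * A)                          ≡⟨ trans (sym (*-assoc t d A)) (trans (cong (_* A) (*-comm t d)) (*-assoc d t A)) ⟩
    d * (t * A)                          ≡⟨ trans (cong (d *_) (sym (sumℕ-*ˡ t (λ v → 𝟙 (alive Y N v))))) (*-comm d (sumℕ W)) ⟩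
    sumℕ W * d                           ≡⟨ sumℕ-*ʳ d W ⟨
    sumℕ (λ v → W v * d)                 ≤⟨ sumℕ-mono (λ v → *-monoʳ-≤ (W v) (d≤degree v)) ⟩
    sumℕ (λ v → W v * degree G v)        ≤⟨ degree-weighted≤edge-marginals w′ ⟩
    sumℕ (λ e → mass w′ points ⁅ edg G e ⁆) ∎
    where
    open ≤-Reasoning
    w′ = condition weights points Y N
    A = aliveStars Y N
    W : Fin (nV G) → ℕ
    W v = w′ (suc v)

  moments : ℚ → Subset (groundSize G) → ℚ
  moments c S = c ℚ.* ℕtoℚ (mass weights points S)

  singletonMoments : ℚ → Fin (groundSize G) → ℚ
  singletonMoments c p = moments c ⁅ p ⁆

  mass-weights-⊥ : mass weights points ⊥ ≡ a + nV G * t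
  mass-weights-⊥ = trans (mass-⊥ weights points) (cong (a +_) (sumℕ-const (nV G) t))

  singletonMoments-inSA : ∀ c .{{_ : ℚ.NonNegative c}} → c ℚ.* ℕtoℚ (a + nV G * t) ≡ 1ℚ →
    InSA r (PVCSystem G t) (singletonMoments c)
  singletonMoments-inSA c normalised =
    moments c , trans (cong (λ k → c ℚ.* ℕtoℚ k) mass-weights-⊥) normalised , (λ p → refl) , inCone
    where
    inCone : ∀ Y N → ∣ Y ∪ N ∣ ≤ r →
      InCone (PVCSystem G t) (momentCol (moments c) Y N ⊥) (λ p → momentCol (moments c) Y N ⁅ p ⁆)
    inCone Y N ∣Y∪N∣≤r =
      inCone-cong (PVCSystem G t) (sym (momentCol-mass c weights points Y N ⊥))
                  (λ p → sym (momentCol-mass c weights points Y N ⁅ p ⁆))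
        (inCone-PVCSystem-scaled G t c (mass w′ points ⊥) (λ p → mass w′ points ⁅ p ⁆)
          (marginal-edge≤ w′) (mass-⁅⁆≤mass-⊥ w′ points) (cover≤ Y N ∣Y∪N∣≤r))
      where w′ = condition weights points Y N

  vertexSum-singletonMoments : ∀ c → vertexSum G (singletonMoments c) ≡ c ℚ.* ℕtoℚ (nV G * t)
  vertexSum-singletonMoments c = begin
    sumℚ (λ i → c ℚ.* ℕtoℚ (mass weights points ⁅ vtx G i ⁆))
      ≡⟨ sumℚ-cong (λ i → cong (λ k → c ℚ.* ℕtoℚ k) (vertex-marginal i)) ⟩
    sumℚ {nV G} (λ _ → c ℚ.* ℕtoℚ t)
      ≡⟨ sumℚ-*ˡ {nV G} c (λ _ → ℕtoℚ t) ⟩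
    c ℚ.* sumℚ {nV G} (λ _ → ℕtoℚ t)
      ≡⟨ cong (c ℚ.*_) (trans (sumℚ-ℕtoℚ {nV G} (λ _ → t)) (cong ℕtoℚ (sumℕ-const (nV G) t))) ⟩
    c ℚ.* ℕtoℚ (nV G * t) ∎
    where open ≡-Reasoning

module BinomialBound where

  open import Data.Nat
  open import Data.Nat.Properties
  open import Data.Nat.Combinatorics using (_C_; nC1≡n; nCk+nC[k+1]≡[n+1]C[k+1])
  open import Data.Nat.Tactic.RingSolver using (solve-∀)

  2*sC2+s≡s*s : ∀ s → 2 * (s C 2) + s ≡ s * s
  2*sC2+s≡s*s zero    = refl
  2*sC2+s≡s*s (suc s) = begin
    2 * (suc s C 2) + suc s          ≡⟨ cong (λ c → 2 * c + suc s) (nCk+nC[k+1]≡[n+1]C[k+1] s 1) ⟨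
    2 * (s C 1 + s C 2) + suc s      ≡⟨ cong (λ c → 2 * (c + s C 2) + suc s) (nC1≡n s) ⟩
    2 * (s + s C 2) + suc s          ≡⟨ regroup s (s C 2) ⟩
    (2 * (s C 2) + s) + suc (s + s)  ≡⟨ cong (_+ suc (s + s)) (2*sC2+s≡s*s s) ⟩
    s * s + suc (s + s)              ≡⟨ square-suc s ⟩
    suc s * suc s ∎
    where
    open ≡-Reasoning
    regroup : ∀ s c → 2 * (s + c) + suc s ≡ (2 * c + s) + suc (s + s)
    regroup = solve-∀
    square-suc : ∀ s → s * s + suc (s + s) ≡ suc s * suc s
    square-suc = solve-∀

  sC2≤s*w : ∀ s w → s ≤ 2 * w + 1 → s C 2 ≤ s * w
  sC2≤s*w s w s≤2w+1 = *-cancelˡ-≤ 2 (+-cancelʳ-≤ s (2 * (s C 2)) (2 * (s * w)) (begin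
    2 * (s C 2) + s    ≡⟨ 2*sC2+s≡s*s s ⟩
    s * s              ≤⟨ *-monoʳ-≤ s s≤2w+1 ⟩
    s * (2 * w + 1)    ≡⟨ expand s w ⟩
    2 * (s * w) + s ∎))
    where
    open ≤-Reasoning
    expand : ∀ s w → s * (2 * w + 1) ≡ 2 * (s * w) + s
    expand = solve-∀

module MinPartialVertexCover where

  open import Data.Nat hiding (_≟_)
  open import Data.Nat.Properties hiding (_≟_)
  open Counting using (sumℕ-cong; sumℕ-const; lookup-⊥)

  ∣p∣≡0⇒p≡⊥ : ∀ {m} (p : Subset m) → ∣ p ∣ ≡ 0 → p ≡ ⊥
  ∣p∣≡0⇒p≡⊥ []          _       = refl
  ∣p∣≡0⇒p≡⊥ (false ∷ p) ∣p∣≡0 = cong (false ∷_) (∣p∣≡0⇒p≡⊥ p ∣p∣≡0)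

  coveredEdges-⊥ : ∀ G → coveredEdges G ⊥ ≡ 0
  coveredEdges-⊥ G = trans (sumℕ-cong uncovered) (trans (sumℕ-const (nE G) 0) (*-zeroʳ (nE G)))
    where
    uncovered : ∀ e → (if lookup ⊥ (proj₁ (ends G e)) ∨ lookup ⊥ (proj₂ (ends G e)) then 1 else 0) ≡ 0
    uncovered e rewrite lookup-⊥ (proj₁ (ends G e)) | lookup-⊥ (proj₂ (ends G e)) = refl

  minPartialVC-positive : ∀ G t k → 1 ≤ t → IsMinPartialVC G t k → 1 ≤ k
  minPartialVC-positive G t (suc k) _ _ = s≤s z≤n
  minPartialVC-positive G t zero 1≤t ((S , t≤cover , ∣S∣≡0) , _) with ∣p∣≡0⇒p≡⊥ S ∣S∣≡0
  ... | refl = contradiction (≤-trans 1≤t (subst (t ≤_) (coveredEdges-⊥ G) t≤cover)) λ ()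

module CompleteGraphGap (n r t : ℕ) (1≤t : 1 ℕ.≤ t) (size : 2 ℕ.* r ℕ.+ 2 ℕ.* t ℕ.+ 2 ℕ.≤ n) where

  open import Data.Nat hiding (_≟_)
  open import Data.Nat.Properties hiding (_≟_)
  open import Data.Nat.Combinatorics using (_C_)
  import Data.Rational as ℚ
  open ℚ using (ℚ; NonNegative)
  import Data.Rational.Properties as ℚP
  open Rationals using (ℕtoℚ-invertible)
  open PartialVertexCoverCone using (scaled-*; scaled-ratio≤)
  open BinomialBound using (sC2≤s*w)

  1≤n : 1 ≤ n
  1≤n = ≤-trans (s≤s z≤n) (≤-trans (m≤n+m 2 (2 * r + 2 * t)) size)

  2t+1≤n∸1 : 2 * t + 1 ≤ n ∸ 1
  2t+1≤n∸1 = begin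
    2 * t + 1                ≡⟨ +-∸-assoc (2 * t) {2} {1} (s≤s z≤n) ⟨
    2 * t + 2 ∸ 1            ≤⟨ ∸-monoˡ-≤ 1 (≤-trans (m≤n+m (2 * t + 2) (2 * r))
                                             (≤-trans (≤-reflexive (sym (+-assoc (2 * r) (2 * t) 2))) size)) ⟩
    n ∸ 1 ∎
    where open ≤-Reasoning

  t≤n∸1 : t ≤ n ∸ 1
  t≤n∸1 = ≤-trans (≤-trans (m≤m+n t (t + 0)) (m≤m+n (2 * t) 1)) 2t+1≤n∸1

  open StarMixture (completeGraph n) r t (n ∸ 1) t≤n∸1 (Degrees.n∸1≤degree-K n) public

  sC2≤a : s C 2 ≤ a
  sC2≤a = sC2≤s*w s w s≤2w+1
    where
    w = n ∸ 1 ∸ t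
    w+t≡n∸1 : w + t ≡ n ∸ 1
    w+t≡n∸1 = m∸n+n≡m t≤n∸1
    t<w : suc t ≤ w
    t<w = +-cancelʳ-≤ t (suc t) w (begin
      suc t + t   ≡⟨ +-comm (suc t) t ⟩
      t + suc t   ≡⟨ +-suc t t ⟩
      suc (t + t) ≡⟨ cong suc (cong (t +_) (+-identityʳ t)) ⟨
      suc (2 * t) ≡⟨ +-comm 1 (2 * t) ⟩
      2 * t + 1   ≤⟨ 2t+1≤n∸1 ⟩
      n ∸ 1       ≡⟨ w+t≡n∸1 ⟨
      w + t ∎)
      where open ≤-Reasoning
    s≤2w+1 : s ≤ 2 * w + 1
    s≤2w+1 = begin
      n ∸ 2 * r     ≤⟨ m∸n≤m n (2 * r) ⟩
      n             ≡⟨ m∸n+n≡m 1≤n ⟨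
      n ∸ 1 + 1     ≡⟨ cong (_+ 1) w+t≡n∸1 ⟨
      w + t + 1     ≤⟨ +-monoˡ-≤ 1 (+-monoʳ-≤ w (≤-trans (n≤1+n t) (≤-trans t<w (≤-reflexive (sym (+-identityʳ w)))))) ⟩
      2 * w + 1 ∎
      where open ≤-Reasoning

  D : ℕ
  D = a + n * t

  1≤D : 1 ≤ D
  1≤D = ≤-trans (*-mono-≤ 1≤n 1≤t) (m≤n+m (n * t) a)

  c : ℚ
  c = proj₁ (ℕtoℚ-invertible D 1≤D)

  instance
    c-nonNeg : NonNegative c
    c-nonNeg = proj₁ (proj₂ (ℕtoℚ-invertible D 1≤D))

  c*D≡1 : c ℚ.* ℕtoℚ D ≡ ℚ.1ℚ
  c*D≡1 = proj₂ (proj₂ (ℕtoℚ-invertible D 1≤D))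

  n*t≤t*n*k : ∀ k → 1 ≤ k → n * t ≤ t * n * k
  n*t≤t*n*k k 1≤k = begin
    n * t       ≡⟨ trans (*-comm n t) (sym (*-identityʳ (t * n))) ⟩
    t * n * 1   ≤⟨ *-monoʳ-≤ (t * n) 1≤k ⟩
    t * n * k ∎
    where open ≤-Reasoning

  vertexSum-bound : ∀ k → 1 ≤ k →
    ℕtoℚ (s C 2) ℚ.* vertexSum (completeGraph n) (singletonMoments c) ℚ.≤ ℕtoℚ (t * n * k)
  vertexSum-bound k 1≤k = begin
    ℕtoℚ (s C 2) ℚ.* vertexSum (completeGraph n) (singletonMoments c)
      ≡⟨ cong (ℕtoℚ (s C 2) ℚ.*_) (vertexSum-singletonMoments c) ⟩
    ℕtoℚ (s C 2) ℚ.* (c ℚ.* ℕtoℚ (n * t))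
      ≡⟨ scaled-* c (s C 2) (n * t) ⟩
    c ℚ.* ℕtoℚ ((s C 2) * (n * t))
      ≤⟨ scaled-ratio≤ c D c*D≡1 (*-mono-≤ (≤-trans sC2≤a (m≤m+n a (n * t))) (n*t≤t*n*k k 1≤k)) ⟩
    ℕtoℚ (t * n * k) ∎
    where open ℚP.≤-Reasoning

open import Data.Nat using (_≤_; _+_; _*_; _∸_)
open import Data.Nat.Combinatorics using (_C_)
import Data.Rational

theorem1 : (n r t : ℕ) → 1 ≤ r → 1 ≤ t → 2 * r + 2 * t + 2 ≤ n →
    ∀ (k : ℕ) → IsMinPartialVC (completeGraph n) t k →
    ∃ λ (x : Data.Fin.Fin (groundSize (completeGraph n)) → Data.Rational.ℚ) →
    InSA r (PVCSystem (completeGraph n) t) x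
    × Data.Rational._≤_
    (Data.Rational._*_ (ℕtoℚ ((n ∸ 2 * r) C 2)) (vertexSum (completeGraph n) x))
    (ℕtoℚ (t * n * k))
theorem1 n r t _ 1≤t size k k-minimum =
  singletonMoments c ,
  singletonMoments-inSA c c*D≡1 ,
  vertexSum-bound k (MinPartialVertexCover.minPartialVC-positive (completeGraph n) t k 1≤t k-minimum)
  where open CompleteGraphGap n r t 1≤t size
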